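{- $\operatorname{Dist}(\mathrm{PX}(4,3))=2$ and $\rho(\mathrm{PX}(4,3))=3=\lceil 4/3\rceil+1$.
   Context: For integers $n\ge 3$ and $1\le k<n$, the Praeger–Xu graph $\mathrm{PX}(n,k)$ is the simple graph with vertex set $\mathbb Z_n\times\mathbb Z_2^k$; a vertex is written $(i,x)$ with $x=x_0x_1\cdots x_{k-1}$ a bitstring of length $k$. Two vertices $(i,x)$ and $(j,y)$ are adjacent if and only if (after possibly swapping the two vertices) $j=i+1$ in $\mathbb Z_n$ and $x=az_1\cdots z_{k-1}$, $y=z_1\cdots z_{k-1}b$ for some bits $a,b,z_1,\dots,z_{k-1}\in\mathbb Z_2$. For a graph $G$, $\operatorname{Dist}(G)$ is the least $d$ such that some $d$-coloring of the vertices is preserved (class-wise) only by the identity automorphism; if $\operatorname{Dist}(G)=2$, $\rho(G)$ is the minimum size of a color class over all 2-colorings preserved only by the identity automorphism. -}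

module Defs where

open import Data.Nat using (ℕ; zero; suc; _<_; _+_; _∸_; NonZero)
open import Data.Nat.DivMod using (_%_; _/_; m%n<n)
open import Data.Fin using (Fin; toℕ; fromℕ<)
open import Data.Bool using (Bool; true; false)
open import Data.Vec using (Vec; []; _∷_; _∷ʳ_)
open import Data.List using (List; []; _∷_; map; concatMap; length; filter; allFin)
open import Data.Product using (Σ; ∃; ∃-syntax; _×_; _,_)
open import Data.Sum using (_⊎_)
open import Relation.Nullary using (¬_)
open import Relation.Binary.PropositionalEquality using (_≡_)
import Data.Fin.Properties as FinP

next : ∀ {n} .{{_ : NonZero n}} → Fin n → Fin n
next {n} i = fromℕ< (m%n<n (suc (toℕ i)) n)

Vertex : ℕ → ℕ → Set
Vertex n k = Fin n × Vec Bool k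

-- Directed "forward" relation: (i,x) → (i+1,y) with x = a z₁⋯z_{k-1}, y = z₁⋯z_{k-1} b.
-- (Only meaningful for k ≥ 1, so k is written as suc k'.)
Forward : ∀ {n k'} .{{_ : NonZero n}} → Vertex n (suc k') → Vertex n (suc k') → Set
Forward {n} {k'} (i , x) (j , y) =
  j ≡ next i × ∃[ a ] ∃[ b ] Σ (Vec Bool k') λ z → (x ≡ a ∷ z) × (y ≡ z ∷ʳ b)

PXAdj : ∀ {n k'} .{{_ : NonZero n}} → Vertex n (suc k') → Vertex n (suc k') → Set
PXAdj u v = Forward u v ⊎ Forward v u

record Graph : Set₁ where
  field
    V   : Set
    Adj : V → V → Set

PX : (n k' : ℕ) .{{_ : NonZero n}} → Graph
PX n k' = record { V = Vertex n (suc k') ; Adj = PXAdj }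

record Automorphism (G : Graph) : Set where
  open Graph G
  field
    to      : V → V
    from    : V → V
    to-from : ∀ v → to (from v) ≡ v
    from-to : ∀ v → from (to v) ≡ v
    adj⇒    : ∀ u v → Adj u v → Adj (to u) (to v)
    adj⇐    : ∀ u v → Adj (to u) (to v) → Adj u v

Distinguishing : (G : Graph) (d : ℕ) → (Graph.V G → Fin d) → Set
Distinguishing G d c =
  (σ : Automorphism G) → (∀ v → c (Automorphism.to σ v) ≡ c v) →
  ∀ v → Automorphism.to σ v ≡ v

DistIs : Graph → ℕ → Set
DistIs G d =
  (∃[ c ] Distinguishing G d c) ×
  (∀ d' → d' < d → ¬ (∃[ c ] Distinguishing G d' c))

allBits : (k : ℕ) → List (Vec Bool k)
allBits zero = [] ∷ []
allBits (suc k) = concatMap (λ b → map (b ∷_) (allBits k)) (true ∷ false ∷ [])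

allVertices : (n k : ℕ) → List (Vertex n k)
allVertices n k = concatMap (λ i → map (i ,_) (allBits k)) (allFin n)

classSize : ∀ {n k' d} → (Vertex n (suc k') → Fin d) → Fin d → ℕ
classSize {n} {k'} c j =
  length (filter (λ v → c v FinP.≟ j) (allVertices n (suc k')))

RhoPXIs : (n k' : ℕ) .{{_ : NonZero n}} → ℕ → Set
RhoPXIs n k' r =
  DistIs (PX n k') 2 ×
  (∃[ c ] (Distinguishing (PX n k') 2 c × ∃[ j ] classSize c j ≡ r)) ×
  (∀ c → Distinguishing (PX n k') 2 c → ∀ j → r Data.Nat.≤ classSize c j)

⌈_/_⌉ : (a b : ℕ) .{{_ : NonZero b}} → ℕ
⌈ a / b ⌉ = (a + b ∸ 1) / b

module Submission where

-- Colouring (0,000), (0,001) and (1,000) with the second colour gives a distinguishing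
-- 2-colouring: an automorphism preserving a vertex labelling also preserves its colour
-- refinement (each vertex additionally labelled by the set of labels on its neighbours),
-- and four rounds of refinement from this colouring already separate all 32 vertices.
--
-- Conversely, every pair {u, v} of vertices (u = v allowed) is fixed or swapped by a
-- non-trivial automorphism.  A colour class with at most two vertices is then preserved by
-- a non-trivial automorphism, which therefore preserves the whole 2-colouring; so every
-- colour class of a distinguishing 2-colouring has at least three vertices.  As the graph
-- is vertex-transitive, it suffices to find these automorphisms for the pairs containing
-- (0,000).  PX(4,3) has 256 automorphisms, twice as many as the group ℤ₂⁴ ⋊ D₄ (translations,
-- rotations, reflections) acting on every PX(n,k), and that subgroup alone leaves some
-- pairs without a non-trivial stabiliser.

open import Defs
open import Data.Nat using (ℕ; zero; suc; _+_; _<_; _≤_; z≤n; s≤s)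
import Data.Nat as ℕ
open import Data.Bool using (Bool; true; false; if_then_else_; _xor_)
import Data.Bool.Properties as Bool
open import Data.Fin using (Fin; zero; suc; opposite; combine)
import Data.Fin.Properties as Fin
open import Data.Vec using (Vec; []; _∷_; reverse; zipWith; lookup)
import Data.Vec.Properties as Vec
open import Data.List using (List; []; _∷_; length; filter; map; concatMap; upTo)
open import Data.List.Membership.Propositional using (_∈_; find; lose)
open import Data.List.Membership.Propositional.Properties
  using (∈-map⁺; ∈-concatMap⁺; ∈-allFin; ∈-filter⁺; ∈-filter⁻)
open import Data.List.Relation.Unary.Any as Any using (Any; here; there; any?)
open import Data.List.Relation.Unary.All as All using (All; all?)
open import Data.Product using (_×_; _,_; proj₁; proj₂; ∃; ∃-syntax)
import Data.Product as Product
import Data.Product.Properties as Product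
open import Data.Sum using (_⊎_; inj₁; inj₂)
import Data.Sum as Sum
open import Data.Empty using (⊥-elim)
open import Function using (_∘_; _⇔_; mk⇔; Equivalence)
import Function.Properties.Equivalence as ⇔
open import Relation.Unary using (Decidable)
open import Relation.Nullary using (¬_; Dec; yes; no; does)
open import Relation.Nullary.Decidable
  using (map′; from-yes; True; toWitness; _×-dec_; _⊎-dec_; _→-dec_; ¬?)
open import Relation.Binary.Definitions using (DecidableEquality)
open import Relation.Binary.PropositionalEquality
  using (_≡_; _≢_; refl; sym; trans; cong; subst; subst₂)

module _ {G : Graph} where
  open Graph G
  open Automorphism

  IsAutomorphism : (to from : V → V) → Set
  IsAutomorphism to from =
    (∀ v → to (from v) ≡ v) × (∀ v → from (to v) ≡ v) × (∀ u v → Adj u v ⇔ Adj (to u) (to v))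

  automorphism : (to from : V → V) → IsAutomorphism to from → Automorphism G
  automorphism to from (to-from , from-to , adj⇔) = record
    { to = to ; from = from ; to-from = to-from ; from-to = from-to
    ; adj⇒ = λ u v → Equivalence.to (adj⇔ u v)
    ; adj⇐ = λ u v → Equivalence.from (adj⇔ u v)
    }

  idᴬ : Automorphism G
  idᴬ = record
    { to = λ v → v ; from = λ v → v ; to-from = λ _ → refl ; from-to = λ _ → refl
    ; adj⇒ = λ _ _ a → a ; adj⇐ = λ _ _ a → a
    }

  infixr 9 _∘ᴬ_
  _∘ᴬ_ : Automorphism G → Automorphism G → Automorphism G
  σ ∘ᴬ τ = record
    { to = to σ ∘ to τ
    ; from = from τ ∘ from σ
    ; to-from = λ v → trans (cong (to σ) (to-from τ (from σ v))) (to-from σ v)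
    ; from-to = λ v → trans (cong (from τ) (from-to σ (to τ v))) (from-to τ v)
    ; adj⇒ = λ u v → adj⇒ σ (to τ u) (to τ v) ∘ adj⇒ τ u v
    ; adj⇐ = λ u v → adj⇐ τ u v ∘ adj⇐ σ (to τ u) (to τ v)
    }

  _⁻¹ᴬ : Automorphism G → Automorphism G
  σ ⁻¹ᴬ = record
    { to = from σ ; from = to σ ; to-from = from-to σ ; from-to = to-from σ
    ; adj⇒ = λ u v a → adj⇐ σ (from σ u) (from σ v)
                         (subst₂ Adj (sym (to-from σ u)) (sym (to-from σ v)) a)
    ; adj⇐ = λ u v a → subst₂ Adj (to-from σ u) (to-from σ v) (adj⇒ σ (from σ u) (from σ v) a)
    }

  _^ᴬ_ : Automorphism G → ℕ → Automorphism G
  σ ^ᴬ zero = idᴬ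
  σ ^ᴬ suc n = σ ∘ᴬ σ ^ᴬ n

  to-injective : (σ : Automorphism G) {u v : V} → to σ u ≡ to σ v → u ≡ v
  to-injective σ {u} {v} eq = trans (sym (from-to σ u)) (trans (cong (from σ) eq) (from-to σ v))

  NonTrivial : Automorphism G → Set
  NonTrivial σ = ∃[ v ] to σ v ≢ v

  FixesOrSwaps : Automorphism G → V → V → Set
  FixesOrSwaps σ u v = (to σ u ≡ u × to σ v ≡ v) ⊎ (to σ u ≡ v × to σ v ≡ u)

  fixesOrSwaps⇒stabilises : ∀ σ {u v} → FixesOrSwaps σ u v →
                            ∀ w → (to σ w ≡ u ⊎ to σ w ≡ v) ⇔ (w ≡ u ⊎ w ≡ v)
  fixesOrSwaps⇒stabilises σ {u} {v} fixesOrSwaps w = mk⇔ (preimage fixesOrSwaps) (image fixesOrSwaps)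
    where
    same-image : ∀ {x y} → to σ w ≡ y → to σ x ≡ y → w ≡ x
    same-image σw≡y σx≡y = to-injective σ (trans σw≡y (sym σx≡y))
    preimage : FixesOrSwaps σ u v → (to σ w ≡ u ⊎ to σ w ≡ v) → (w ≡ u ⊎ w ≡ v)
    preimage (inj₁ (σu , σv)) = Sum.map (λ e → same-image e σu) (λ e → same-image e σv)
    preimage (inj₂ (σu , σv)) = Sum.swap ∘ Sum.map (λ e → same-image e σv) (λ e → same-image e σu)
    image : FixesOrSwaps σ u v → (w ≡ u ⊎ w ≡ v) → (to σ w ≡ u ⊎ to σ w ≡ v)
    image (inj₁ (σu , σv)) (inj₁ refl) = inj₁ σu
    image (inj₁ (σu , σv)) (inj₂ refl) = inj₂ σv
    image (inj₂ (σu , σv)) (inj₁ refl) = inj₂ σu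
    image (inj₂ (σu , σv)) (inj₂ refl) = inj₁ σv

  module _ (g h : Automorphism G) where
    private
      conj-to : ∀ u → to (g ∘ᴬ h ∘ᴬ g ⁻¹ᴬ) (to g u) ≡ to g (to h u)
      conj-to u = cong (to g ∘ to h) (from-to g u)

    conjugate-fixesOrSwaps : ∀ {u v} → FixesOrSwaps h u v →
                             FixesOrSwaps (g ∘ᴬ h ∘ᴬ g ⁻¹ᴬ) (to g u) (to g v)
    conjugate-fixesOrSwaps = Sum.map (Product.map conj-maps conj-maps) (Product.map conj-maps conj-maps)
      where
      conj-maps : ∀ {u x} → to h u ≡ x → to (g ∘ᴬ h ∘ᴬ g ⁻¹ᴬ) (to g u) ≡ to g x
      conj-maps {u} e = trans (conj-to u) (cong (to g) e)

    conjugate-nonTrivial : NonTrivial h → NonTrivial (g ∘ᴬ h ∘ᴬ g ⁻¹ᴬ)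
    conjugate-nonTrivial (v , moved) = to g v , moved ∘ to-injective g ∘ trans (sym (conj-to v))

  -- Conjugating by an automorphism moving v₀ to u transports the stabilisers.
  pairs-nonTrivially-stabilised :
    (v₀ : V) → (∀ u → ∃[ g ] to g v₀ ≡ u) →
    (∀ w → ∃[ h ] FixesOrSwaps h v₀ w × NonTrivial h) →
    ∀ u v → ∃[ σ ] FixesOrSwaps σ u v × NonTrivial σ
  pairs-nonTrivially-stabilised v₀ transitive stabilised u v
    with g , gv₀≡u ← transitive u
    with h , fixesOrSwaps , nonTrivial ← stabilised (from g v)
    = g ∘ᴬ h ∘ᴬ g ⁻¹ᴬ
    , subst₂ (FixesOrSwaps (g ∘ᴬ h ∘ᴬ g ⁻¹ᴬ)) gv₀≡u (to-from g v)
             (conjugate-fixesOrSwaps g h fixesOrSwaps)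
    , conjugate-nonTrivial g h nonTrivial

  Invariant : {A : Set} → Automorphism G → (V → A) → Set
  Invariant σ L = ∀ v → L (to σ v) ≡ L v

  nonTrivial⇒¬invariant : ∀ {d c} → Distinguishing G d c → ∀ {σ} → NonTrivial σ → ¬ Invariant σ c
  nonTrivial⇒¬invariant distinguishing {σ} (v , moved) invariant = moved (distinguishing σ invariant v)

  noDistinguishing<2 : V → ∀ {σ} → NonTrivial σ → ∀ d → d < 2 → ¬ (∃[ c ] Distinguishing G d c)
  noDistinguishing<2 v₀ _ zero _ (c , _) with () ← c v₀
  noDistinguishing<2 _ {σ} nonTrivial (suc zero) _ (c , distinguishing) =
    nonTrivial⇒¬invariant distinguishing {σ} nonTrivial λ v → one-colour (c (to σ v)) (c v)
    where
    one-colour : (x y : Fin 1) → x ≡ y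
    one-colour zero zero = refl
  noDistinguishing<2 _ _ (suc (suc _)) (s≤s (s≤s ()))

  classInvariant⇒invariant : ∀ c j σ → (∀ v → c (to σ v) ≡ j ⇔ c v ≡ j) → Invariant σ c
  classInvariant⇒invariant c j σ class v = two-colours j (c (to σ v)) (c v) (class v)
    where
    two-colours : ∀ (j x y : Fin 2) → x ≡ j ⇔ y ≡ j → x ≡ y
    two-colours _          zero       zero       _ = refl
    two-colours _          (suc zero) (suc zero) _ = refl
    two-colours zero       zero       (suc zero) x⇔y with () ← Equivalence.to x⇔y refl
    two-colours (suc zero) (suc zero) zero       x⇔y with () ← Equivalence.to x⇔y refl
    two-colours zero       (suc zero) zero       x⇔y with () ← Equivalence.from x⇔y refl
    two-colours (suc zero) zero       (suc zero) x⇔y with () ← Equivalence.from x⇔y refl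

  module _ (stabilised : ∀ u v → ∃[ σ ] FixesOrSwaps σ u v × NonTrivial σ)
           {c : V → Fin 2} (distinguishing : Distinguishing G 2 c) (j : Fin 2) where

    pairClass-impossible : ∀ a b → ¬ (∀ v → (v ≡ a ⊎ v ≡ b) ⇔ c v ≡ j)
    pairClass-impossible a b class with σ , fixesOrSwaps , nonTrivial ← stabilised a b =
      nonTrivial⇒¬invariant distinguishing {σ} nonTrivial
        (classInvariant⇒invariant c j σ λ v →
          ⇔.trans (⇔.sym (class (to σ v)))
                  (⇔.trans (fixesOrSwaps⇒stabilises σ fixesOrSwaps v) (class v)))

    emptyClass-impossible : V → ¬ (∀ v → c v ≢ j)
    emptyClass-impossible v₀ empty with σ , _ , nonTrivial ← stabilised v₀ v₀ =
      nonTrivial⇒¬invariant distinguishing {σ} nonTrivial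
        (classInvariant⇒invariant c j σ λ v → mk⇔ (⊥-elim ∘ empty (to σ v)) (⊥-elim ∘ empty v))

    colourClass-≥3 : V → (xs : List V) → (∀ v → v ∈ xs ⇔ c v ≡ j) → 3 ≤ length xs
    colourClass-≥3 _ (_ ∷ _ ∷ _ ∷ _) _ = s≤s (s≤s (s≤s z≤n))
    colourClass-≥3 v₀ [] class =
      ⊥-elim (emptyClass-impossible v₀ λ v → (λ ()) ∘ Equivalence.from (class v))
    colourClass-≥3 _ (a ∷ []) class =
      ⊥-elim (pairClass-impossible a a λ v → ⇔.trans singleton (class v))
      where
      singleton : ∀ {v} → (v ≡ a ⊎ v ≡ a) ⇔ v ∈ a ∷ []
      singleton = mk⇔ Sum.[ here , here ] λ { (here e) → inj₁ e ; (there ()) }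
    colourClass-≥3 _ (a ∷ b ∷ []) class =
      ⊥-elim (pairClass-impossible a b λ v → ⇔.trans pair (class v))
      where
      pair : ∀ {v} → (v ≡ a ⊎ v ≡ b) ⇔ v ∈ a ∷ b ∷ []
      pair = mk⇔ Sum.[ here , there ∘ here ]
                 λ { (here e) → inj₁ e ; (there (here e)) → inj₂ e ; (there (there ())) }

  module _ {A : Set} where

    NeighbourLabels⊆ : (V → A) → V → V → Set
    NeighbourLabels⊆ L u v = ∀ x → Adj x u → ∃[ y ] Adj y v × L y ≡ L x

    SameNeighbourLabels : (V → A) → V → V → Set
    SameNeighbourLabels L u v = NeighbourLabels⊆ L u v × NeighbourLabels⊆ L v u

    Refines : {B : Set} → (V → A) → (V → B) → Set
    Refines L L' = ∀ u v → L u ≡ L v → SameNeighbourLabels L u v → L' u ≡ L' v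

    invariant⇒sameNeighbourLabels : ∀ σ {L} → Invariant σ L → ∀ v → SameNeighbourLabels L (to σ v) v
    invariant⇒sameNeighbourLabels σ {L} invariant v = backward , forward
      where
      backward : NeighbourLabels⊆ L (to σ v) v
      backward x x~σv =
        from σ x
        , adj⇐ σ (from σ x) v (subst (λ z → Adj z (to σ v)) (sym (to-from σ x)) x~σv)
        , trans (sym (invariant (from σ x))) (cong L (to-from σ x))
      forward : NeighbourLabels⊆ L v (to σ v)
      forward y y~v = to σ y , adj⇒ σ y v y~v , invariant y

    refines-invariant : ∀ {B : Set} σ {L} {L' : V → B} → Refines L L' → Invariant σ L → Invariant σ L'
    refines-invariant σ refines invariant v =
      refines (to σ v) v (invariant v) (invariant⇒sameNeighbourLabels σ invariant v)

    invariant-injective⇒identity : ∀ σ {L : V → A} → (∀ u v → L u ≡ L v → u ≡ v) →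
                                   Invariant σ L → ∀ v → to σ v ≡ v
    invariant-injective⇒identity σ injective invariant v = injective (to σ v) v (invariant v)

module Exhaustive {A : Set} {xs : List A} (complete : ∀ x → x ∈ xs) where

  ∀? : {P : A → Set} → Decidable P → Dec (∀ x → P x)
  ∀? P? = map′ (λ all x → All.lookup all (complete x)) (λ p → All.tabulate λ {x} _ → p x) (all? P? xs)

  ∃? : {P : A → Set} → Decidable P → Dec (∃ P)
  ∃? P? = map′ Any.satisfied (λ (x , p) → Any.map (λ { refl → p }) (complete x)) (any? P? xs)

infix 2 _⇔?_
_⇔?_ : {A B : Set} → Dec A → Dec B → Dec (A ⇔ B)
a? ⇔? b? = map′ (Product.uncurry mk⇔) (λ e → Equivalence.to e , Equivalence.from e)
                ((a? →-dec b?) ×-dec (b? →-dec a?))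

∈-allBits : ∀ {k} (x : Vec Bool k) → x ∈ allBits k
∈-allBits [] = here refl
∈-allBits {suc k} (b ∷ x) =
  ∈-concatMap⁺ (λ b → map (b ∷_) (allBits k))
    (Any.map (λ { refl → ∈-map⁺ (b ∷_) (∈-allBits x) }) (∈-bools b))
  where
  ∈-bools : ∀ b → b ∈ true ∷ false ∷ []
  ∈-bools true = here refl
  ∈-bools false = there (here refl)

∈-allVertices : ∀ {n k} (v : Vertex n k) → v ∈ allVertices n k
∈-allVertices {k = k} (i , x) =
  ∈-concatMap⁺ (λ i → map (i ,_) (allBits k))
    (Any.map (λ { refl → ∈-map⁺ (i ,_) (∈-allBits x) }) (∈-allFin i))

V : Set
V = Vertex 4 3

PX₄₃ : Graph
PX₄₃ = PX 4 2

open Exhaustive (∈-allVertices {4} {3}) using () renaming (∀? to ∀ᵥ?; ∃? to ∃ᵥ?)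
open Exhaustive (∈-allBits {4}) using () renaming (∀? to ∀ᵇ?)

infix 4 _≟ᵥ_
_≟ᵥ_ : DecidableEquality V
_≟ᵥ_ = Product.≡-dec Fin._≟_ (Vec.≡-dec Bool._≟_)

open import Data.List.Membership.DecPropositional _≟ᵥ_ using (_∈?_)

forward? : (u v : V) → Dec (Forward u v)
forward? (i , x₀ ∷ x₁ ∷ x₂ ∷ []) (j , y₀ ∷ y₁ ∷ y₂ ∷ []) with j Fin.≟ next i | x₁ Bool.≟ y₀ | x₂ Bool.≟ y₁
... | yes j≡i+1 | yes refl | yes refl = yes (j≡i+1 , x₀ , y₂ , x₁ ∷ x₂ ∷ [] , refl , refl)
... | no j≢i+1 | _ | _ = no (j≢i+1 ∘ proj₁)
... | yes _ | no x₁≢y₀ | _ = no λ { (_ , _ , _ , _ ∷ _ ∷ [] , refl , refl) → x₁≢y₀ refl }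
... | yes _ | yes _ | no x₂≢y₁ = no λ { (_ , _ , _ , _ ∷ _ ∷ [] , refl , refl) → x₂≢y₁ refl }

adj? : (u v : V) → Dec (Graph.Adj PX₄₃ u v)
adj? u v = forward? u v ⊎-dec forward? v u

neighbours : V → List V
neighbours (i , a ∷ b ∷ c ∷ []) =
  (next i , b ∷ c ∷ false ∷ []) ∷ (next i , b ∷ c ∷ true ∷ []) ∷
  (previous , false ∷ a ∷ b ∷ []) ∷ (previous , true ∷ a ∷ b ∷ []) ∷ []
  where
  previous : Fin 4
  previous = next (next (next i))

opaque
  adj⇔∈neighbours : ∀ x u → Graph.Adj PX₄₃ x u ⇔ x ∈ neighbours u
  adj⇔∈neighbours = from-yes (∀ᵥ? λ x → ∀ᵥ? λ u → adj? x u ⇔? x ∈? neighbours u)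

isAutomorphism? : (to from : V → V) → Dec (IsAutomorphism {PX₄₃} to from)
isAutomorphism? to from =
  ∀ᵥ? (λ v → to (from v) ≟ᵥ v) ×-dec ∀ᵥ? (λ v → from (to v) ≟ᵥ v) ×-dec
  ∀ᵥ? λ u → ∀ᵥ? λ v → adj? u v ⇔? adj? (to u) (to v)

checkedAutomorphism : (to from : V → V) → {True (isAutomorphism? to from)} → Automorphism PX₄₃
checkedAutomorphism to from {checked} = automorphism to from (toWitness checked)

pattern 0F = zero
pattern 1F = suc zero
pattern 2F = suc (suc zero)
pattern 3F = suc (suc (suc zero))

v₀ : V
v₀ = 0F , false ∷ false ∷ false ∷ []

rotate reflect : V → V
rotate (i , x) = next i , x
reflect (i , x) = opposite i , reverse x
-- Bit t of a vertex over i sits at position i + t of ℤ₄; translate f flips the bits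
-- at the positions where f is true.
window : Fin 4 → Vec Bool 4 → Vec Bool 3
window 0F (a ∷ b ∷ c ∷ d ∷ []) = a ∷ b ∷ c ∷ []
window 1F (a ∷ b ∷ c ∷ d ∷ []) = b ∷ c ∷ d ∷ []
window 2F (a ∷ b ∷ c ∷ d ∷ []) = c ∷ d ∷ a ∷ []
window 3F (a ∷ b ∷ c ∷ d ∷ []) = d ∷ a ∷ b ∷ []

translate : Vec Bool 4 → V → V
translate f (i , x) = i , zipWith _xor_ (window i f) x

-- An involution outside ℤ₂⁴ ⋊ D₄, found by computer search.
sporadic : V → V
sporadic (0F , false ∷ false ∷ false ∷ []) = (0F , false ∷ false ∷ false ∷ [])
sporadic (0F , false ∷ false ∷ true ∷ []) = (2F , false ∷ true ∷ false ∷ [])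
sporadic (0F , false ∷ true ∷ false ∷ []) = (0F , true ∷ false ∷ true ∷ [])
sporadic (0F , false ∷ true ∷ true ∷ []) = (2F , true ∷ true ∷ true ∷ [])
sporadic (0F , true ∷ false ∷ false ∷ []) = (2F , false ∷ false ∷ false ∷ [])
sporadic (0F , true ∷ false ∷ true ∷ []) = (0F , false ∷ true ∷ false ∷ [])
sporadic (0F , true ∷ true ∷ false ∷ []) = (2F , true ∷ false ∷ true ∷ [])
sporadic (0F , true ∷ true ∷ true ∷ []) = (0F , true ∷ true ∷ true ∷ [])
sporadic (1F , false ∷ false ∷ false ∷ []) = (1F , false ∷ false ∷ false ∷ [])
sporadic (1F , false ∷ false ∷ true ∷ []) = (3F , false ∷ false ∷ false ∷ [])
sporadic (1F , false ∷ true ∷ false ∷ []) = (1F , true ∷ false ∷ true ∷ [])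
sporadic (1F , false ∷ true ∷ true ∷ []) = (3F , true ∷ false ∷ true ∷ [])
sporadic (1F , true ∷ false ∷ false ∷ []) = (3F , false ∷ true ∷ false ∷ [])
sporadic (1F , true ∷ false ∷ true ∷ []) = (1F , false ∷ true ∷ false ∷ [])
sporadic (1F , true ∷ true ∷ false ∷ []) = (3F , true ∷ true ∷ true ∷ [])
sporadic (1F , true ∷ true ∷ true ∷ []) = (1F , true ∷ true ∷ true ∷ [])
sporadic (2F , false ∷ false ∷ false ∷ []) = (0F , true ∷ false ∷ false ∷ [])
sporadic (2F , false ∷ false ∷ true ∷ []) = (2F , false ∷ false ∷ true ∷ [])
sporadic (2F , false ∷ true ∷ false ∷ []) = (0F , false ∷ false ∷ true ∷ [])
sporadic (2F , false ∷ true ∷ true ∷ []) = (2F , true ∷ false ∷ false ∷ [])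
sporadic (2F , true ∷ false ∷ false ∷ []) = (2F , false ∷ true ∷ true ∷ [])
sporadic (2F , true ∷ false ∷ true ∷ []) = (0F , true ∷ true ∷ false ∷ [])
sporadic (2F , true ∷ true ∷ false ∷ []) = (2F , true ∷ true ∷ false ∷ [])
sporadic (2F , true ∷ true ∷ true ∷ []) = (0F , false ∷ true ∷ true ∷ [])
sporadic (3F , false ∷ false ∷ false ∷ []) = (1F , false ∷ false ∷ true ∷ [])
sporadic (3F , false ∷ false ∷ true ∷ []) = (3F , true ∷ true ∷ false ∷ [])
sporadic (3F , false ∷ true ∷ false ∷ []) = (1F , true ∷ false ∷ false ∷ [])
sporadic (3F , false ∷ true ∷ true ∷ []) = (3F , false ∷ true ∷ true ∷ [])
sporadic (3F , true ∷ false ∷ false ∷ []) = (3F , true ∷ false ∷ false ∷ [])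
sporadic (3F , true ∷ false ∷ true ∷ []) = (1F , false ∷ true ∷ true ∷ [])
sporadic (3F , true ∷ true ∷ false ∷ []) = (3F , false ∷ false ∷ true ∷ [])
sporadic (3F , true ∷ true ∷ true ∷ []) = (1F , true ∷ true ∷ false ∷ [])
opaque
  translate-isAutomorphism : ∀ f → IsAutomorphism {PX₄₃} (translate f) (translate f)
  translate-isAutomorphism = from-yes (∀ᵇ? λ f → isAutomorphism? (translate f) (translate f))

rotateᴬ reflectᴬ sporadicᴬ : Automorphism PX₄₃
rotateᴬ = checkedAutomorphism rotate (rotate ∘ rotate ∘ rotate)
reflectᴬ = checkedAutomorphism reflect reflect
sporadicᴬ = checkedAutomorphism sporadic sporadic

translateᴬ : Vec Bool 4 → Automorphism PX₄₃
translateᴬ f = automorphism (translate f) (translate f) (translate-isAutomorphism f)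

symmetries : List (Automorphism PX₄₃)
symmetries =
  concatMap (λ e → concatMap (λ f → concatMap (λ s → map (λ r →
    sporadicᴬ ^ᴬ e ∘ᴬ translateᴬ f ∘ᴬ reflectᴬ ^ᴬ s ∘ᴬ rotateᴬ ^ᴬ r)
    (upTo 4)) (upTo 2)) (allBits 4)) (upTo 2)

nonTrivial? : (σ : Automorphism PX₄₃) → Dec (NonTrivial σ)
nonTrivial? σ = ∃ᵥ? λ v → ¬? (Automorphism.to σ v ≟ᵥ v)

fixesOrSwaps? : (σ : Automorphism PX₄₃) (u v : V) → Dec (FixesOrSwaps σ u v)
fixesOrSwaps? σ u v = (σ⟨ u ⟩≟ u ×-dec σ⟨ v ⟩≟ v) ⊎-dec (σ⟨ u ⟩≟ v ×-dec σ⟨ v ⟩≟ u)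
  where
  σ⟨_⟩≟_ : (x y : V) → Dec (Automorphism.to σ x ≡ y)
  σ⟨ x ⟩≟ y = Automorphism.to σ x ≟ᵥ y

opaque
  vertexTransitive : ∀ u → ∃ λ (g : Automorphism PX₄₃) → Automorphism.to g v₀ ≡ u
  vertexTransitive u = Any.satisfied (reaches u)
    where
    reaches : ∀ u → Any (λ g → Automorphism.to g v₀ ≡ u) symmetries
    reaches = from-yes (∀ᵥ? λ u → any? (λ g → Automorphism.to g v₀ ≟ᵥ u) symmetries)

  pairsThrough-v₀-stabilised : ∀ w → ∃ λ (h : Automorphism PX₄₃) → FixesOrSwaps h v₀ w × NonTrivial h
  pairsThrough-v₀-stabilised w = Any.satisfied (stabilised w)
    where
    stabilised : ∀ w → Any (λ h → FixesOrSwaps h v₀ w × NonTrivial h) symmetries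
    stabilised = from-yes (∀ᵥ? λ w → any? (λ h → fixesOrSwaps? h v₀ w ×-dec nonTrivial? h) symmetries)

pairs-stabilised : ∀ u v → ∃ λ (σ : Automorphism PX₄₃) → FixesOrSwaps σ u v × NonTrivial σ
pairs-stabilised = pairs-nonTrivially-stabilised v₀ vertexTransitive pairsThrough-v₀-stabilised

marked : List V
marked = (0F , false ∷ false ∷ false ∷ []) ∷ (0F , false ∷ false ∷ true ∷ []) ∷
         (1F , false ∷ false ∷ false ∷ []) ∷ []

colouring : V → Fin 2
colouring v = if does (v ∈? marked) then 1F else 0F

module _ {A : Set} (_≟_ : DecidableEquality A) (L : V → A) where

  neighbourLabels⊆? : (u v : V) → Dec (NeighbourLabels⊆ {PX₄₃} L u v)
  neighbourLabels⊆? u v =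
    map′ cover uncover (all? (λ x → any? (λ y → L y ≟ L x) (neighbours v)) (neighbours u))
    where
    Covered : Set
    Covered = All (λ x → Any (λ y → L y ≡ L x) (neighbours v)) (neighbours u)
    cover : Covered → NeighbourLabels⊆ {PX₄₃} L u v
    cover covered x x~u
      with y , y∈ , same ← find (All.lookup covered (Equivalence.to (adj⇔∈neighbours x u) x~u)) =
      y , Equivalence.from (adj⇔∈neighbours y v) y∈ , same
    uncover : NeighbourLabels⊆ {PX₄₃} L u v → Covered
    uncover covering = All.tabulate λ {x} x∈ →
      let y , y~v , same = covering x (Equivalence.from (adj⇔∈neighbours x u) x∈)
      in lose (Equivalence.to (adj⇔∈neighbours y v) y~v) same

  refines? : (L' : V → ℕ) → Dec (Refines {PX₄₃} L L')
  refines? L' = ∀ᵥ? λ u → ∀ᵥ? λ v →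
    L u ≟ L v →-dec (neighbourLabels⊆? u v ×-dec neighbourLabels⊆? v u) →-dec L' u ℕ.≟ L' v

index : V → Fin 32
index (i , a ∷ b ∷ c ∷ []) = combine i (combine (bit a) (combine (bit b) (bit c)))
  where
  bit : Bool → Fin 2
  bit false = 0F
  bit true = 1F

label : Vec ℕ 32 → V → ℕ
label table v = lookup table (index v)

-- Successive rounds of colour refinement from the colouring, computed offline.
round₁ round₂ round₃ round₄ : Vec ℕ 32
round₁ = 2 ∷ 3 ∷ 1 ∷ 1 ∷ 0 ∷ 1 ∷ 1 ∷ 1 ∷ 2 ∷ 0 ∷ 0 ∷ 0 ∷ 1 ∷ 1 ∷ 1 ∷ 1 ∷ 0 ∷ 0 ∷ 1 ∷ 1 ∷ 1 ∷ 1 ∷ 1 ∷ 1 ∷ 0 ∷ 1 ∷ 1 ∷ 1 ∷ 0 ∷ 1 ∷ 1 ∷ 1 ∷ []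
round₂ = 7 ∷ 8 ∷ 6 ∷ 6 ∷ 1 ∷ 5 ∷ 6 ∷ 6 ∷ 7 ∷ 1 ∷ 4 ∷ 4 ∷ 5 ∷ 6 ∷ 6 ∷ 6 ∷ 1 ∷ 3 ∷ 5 ∷ 5 ∷ 5 ∷ 5 ∷ 5 ∷ 5 ∷ 0 ∷ 5 ∷ 5 ∷ 5 ∷ 2 ∷ 6 ∷ 5 ∷ 6 ∷ []
round₃ = 17 ∷ 19 ∷ 16 ∷ 16 ∷ 2 ∷ 15 ∷ 16 ∷ 16 ∷ 18 ∷ 2 ∷ 5 ∷ 5 ∷ 9 ∷ 16 ∷ 16 ∷ 16 ∷ 1 ∷ 4 ∷ 7 ∷ 10 ∷ 6 ∷ 14 ∷ 12 ∷ 14 ∷ 0 ∷ 10 ∷ 8 ∷ 13 ∷ 3 ∷ 16 ∷ 11 ∷ 16 ∷ []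
round₄ = 19 ∷ 21 ∷ 17 ∷ 12 ∷ 23 ∷ 9 ∷ 18 ∷ 15 ∷ 20 ∷ 22 ∷ 27 ∷ 26 ∷ 31 ∷ 11 ∷ 16 ∷ 13 ∷ 1 ∷ 25 ∷ 29 ∷ 3 ∷ 28 ∷ 8 ∷ 5 ∷ 7 ∷ 0 ∷ 2 ∷ 30 ∷ 6 ∷ 24 ∷ 14 ∷ 4 ∷ 10 ∷ []
opaque
  refinement₁ : Refines {PX₄₃} colouring (label round₁)
  refinement₁ = from-yes (refines? Fin._≟_ colouring (label round₁))

  refinement₂ : Refines {PX₄₃} (label round₁) (label round₂)
  refinement₂ = from-yes (refines? ℕ._≟_ (label round₁) (label round₂))

  refinement₃ : Refines {PX₄₃} (label round₂) (label round₃)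
  refinement₃ = from-yes (refines? ℕ._≟_ (label round₂) (label round₃))

  refinement₄ : Refines {PX₄₃} (label round₃) (label round₄)
  refinement₄ = from-yes (refines? ℕ._≟_ (label round₃) (label round₄))

  round₄-injective : ∀ u v → label round₄ u ≡ label round₄ v → u ≡ v
  round₄-injective = from-yes (∀ᵥ? λ u → ∀ᵥ? λ v → label round₄ u ℕ.≟ label round₄ v →-dec u ≟ᵥ v)

colouring-distinguishing : Distinguishing PX₄₃ 2 colouring
colouring-distinguishing σ invariant₀ = invariant-injective⇒identity σ round₄-injective invariant₄
  where
  invariant₁ : Invariant σ (label round₁)
  invariant₁ = refines-invariant σ refinement₁ invariant₀
  invariant₂ : Invariant σ (label round₂)
  invariant₂ = refines-invariant σ refinement₂ invariant₁
  invariant₃ : Invariant σ (label round₃)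
  invariant₃ = refines-invariant σ refinement₃ invariant₂
  invariant₄ : Invariant σ (label round₄)
  invariant₄ = refines-invariant σ refinement₄ invariant₃

∈-colourClass⇔ : ∀ (c : V → Fin 2) j v → v ∈ filter (λ v → c v Fin.≟ j) (allVertices 4 3) ⇔ c v ≡ j
∈-colourClass⇔ c j v =
  mk⇔ (proj₂ ∘ ∈-filter⁻ (λ v → c v Fin.≟ j)) (∈-filter⁺ (λ v → c v Fin.≟ j) (∈-allVertices v))

dist-PX₄₃ : DistIs PX₄₃ 2
dist-PX₄₃ = (colouring , colouring-distinguishing) , noDistinguishing<2 v₀ {rotateᴬ} (v₀ , λ ())

theorem6p1 : DistIs (PX 4 2) 2 × RhoPXIs 4 2 3 × 3 ≡ ⌈ 4 / 3 ⌉ + 1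
theorem6p1 = dist-PX₄₃ , (dist-PX₄₃ , (colouring , colouring-distinguishing , 1F , refl) , classes-≥3) , refl
  where
  classes-≥3 : ∀ c → Distinguishing PX₄₃ 2 c → ∀ j → 3 ≤ classSize c j
  classes-≥3 c distinguishing j =
    colourClass-≥3 pairs-stabilised distinguishing j v₀ _ (∈-colourClass⇔ c j)
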